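{- Let $\mathcal A=\langle A;\Xi\rangle$ be an algebra, $f\colon A\to A$ and $L\subseteq A$. For $a\in A$ let $X_{a,L}=\{\gamma\in\mathrm{Freez}^*(\mathcal A): a\in\gamma^{ -1}(L)\}$ and $Y_{a,L}=\{\gamma\in\mathrm{Freez}^*(\mathcal A): a\notin\gamma^{ -1}(L)\}$. (1) If $f$ preserves $\sim_L$ (i.e. $x\sim_L y\Rightarrow f(x)\sim_L f(y)$), then $$f^{ -1}(L)=\bigcup_{a\in f^{ -1}(L)}\{x: x\sim_L a\}=\bigcup_{a\in f^{ -1}(L)}\Big(\bigcap_{\gamma\in X_{a,L}}\gamma^{ -1}(L)\cap\bigcap_{\gamma\in Y_{a,L}}(A\setminus\gamma^{ -1}(L))\Big);$$ in particular $f^{ -1}(L)\in\mathrm{Bool}^{\infty}_{\mathcal A}(L)$. Moreover, if $L$ is $\mathcal A$-recognizable then $\mathrm{Bool}^{\emptyset,A}_{\mathcal A}(L)=\mathrm{Bool}^{\infty}_{\mathcal A}(L)$ and it is finite. (2) If $f$ preserves $\preceq_L$, then $$f^{ -1}(L)=\bigcup_{a\in f^{ -1}(L)}\{x: x\preceq_L a\}=\bigcup_{a\in f^{ -1}(L)}\ \bigcap_{\gamma\in X_{a,L}}\gamma^{ -1}(L);$$ in particular $f^{ -1}(L)\in\mathrm{Latt}^{\infty}_{\mathcal A}(L)$. Moreover, if $L$ is $\mathcal A$-recognizable then $\mathrm{Latt}^{\emptyset,A}_{\mathcal A}(L)=\mathrm{Latt}^{\infty}_{\mathcal A}(L)$ and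 it is finite.
   Context: An algebra $\mathcal A=\langle A;\Xi\rangle$ is a nonempty set with operations; an $\mathcal A$-congruence is an equivalence relation compatible with every operation; $L$ is $\mathcal A$-recognizable if it is a union of classes of some $\mathcal A$-congruence with finitely many classes. The 1-freezifications of an operation $\xi$ of arity $n\ge2$ are the maps $x\mapsto\xi(c_1,\dots,c_{i-1},x,c_{i+1},\dots,c_n)$ with $c_j\in A$; a unary operation is its own 1-freezification; $\mathrm{Freez}^*(\mathcal A)$ is the set of finite (possibly empty, giving the identity) compositions of 1-freezifications. Syntactic preorder/congruence: $x\preceq_L y$ iff $\gamma(y)\in L\Rightarrow\gamma(x)\in L$ for all $\gamma\in\mathrm{Freez}^*(\mathcal A)$; $x\sim_L y$ iff $\gamma(y)\in L\Leftrightarrow\gamma(x)\in L$ for all such $\gamma$. Empty unions are $\emptyset$ and empty intersections are $A$. $\mathrm{Latt}^{\emptyset,A}_{\mathcal A}(L)$ (resp. $\mathrm{Bool}^{\emptyset,A}_{\mathcal A}(L)$) is the smallest family of subsets of $A$ containing $L,\emptyset,A$ closed under finite unions and intersections (resp. and complementation) and under $X\mapsto\gamma^{ -1}(X)$ for all $\gamma\in\mathrm{Freez}^*(\mathcal A)$; $\mathrm{Latt}^{\infty}_{\mathcal A}(L)$ (resp. $\mathrm{Bool}^{\infty}_{\mathcal A}(L)$) is the smallest family containing $L$ closed under arbitrary (including empty) unions and intersections (resp. and complementation) and under all $\gamma^{ -1}$. -}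

module Defs where

open import Data.Nat using (ℕ; _≤_)
open import Data.Fin using (Fin; _≟_)
open import Data.Product using (Σ; _×_; _,_)
open import Data.Sum using (_⊎_)
open import Data.Empty using (⊥)
open import Data.Unit using (⊤)
open import Data.List using (List)
open import Data.List.Relation.Unary.Any using (Any)
open import Relation.Nullary using (¬_; yes; no)
open import Relation.Binary.PropositionalEquality using (_≡_)
open import Relation.Binary.Structures using (IsEquivalence)

record Algebra : Set₁ where
  field
    Carrier  : Set
    nonempty : Carrier
    Op       : Set
    arity    : Op → ℕ
    op       : (ξ : Op) → (Fin (arity ξ) → Carrier) → Carrier

Subset : Set → Set₁
Subset A = A → Set

module _ {A : Set} where

  _≐_ : Subset A → Subset A → Set
  X ≐ Y = ∀ x → (X x → Y x) × (Y x → X x)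

  ∅ : Subset A
  ∅ _ = ⊥

  Full : Subset A
  Full _ = ⊤

  _∪_ : Subset A → Subset A → Subset A
  (X ∪ Y) x = X x ⊎ Y x

  _∩_ : Subset A → Subset A → Subset A
  (X ∩ Y) x = X x × Y x

  ∁ : Subset A → Subset A
  ∁ X x = ¬ X x

  ⋃ : (I : Set) → (I → Subset A) → Subset A
  ⋃ I F x = Σ I λ i → F i x

  ⋂ : (I : Set) → (I → Subset A) → Subset A
  ⋂ I F x = (i : I) → F i x

  _⁻¹[_] : (A → A) → Subset A → Subset A
  (g ⁻¹[ X ]) x = X (g x)

  FiniteFamily : (Subset A → Set₁) → Set₁
  FiniteFamily 𝓕 = Σ (List (Subset A)) λ Xs →
    ∀ X → 𝓕 X → Any (λ Y → X ≐ Y) Xs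

  SameFamily : (Subset A → Set₁) → (Subset A → Set₁) → Set₁
  SameFamily 𝓕 𝓖 = (∀ X → 𝓕 X → 𝓖 X) × (∀ X → 𝓖 X → 𝓕 X)

module _ (𝒜 : Algebra) where
  open Algebra 𝒜 renaming (Carrier to A)

  plug : {n : ℕ} → Fin n → (Fin n → A) → A → Fin n → A
  plug k c x j with j ≟ k
  ... | yes _ = x
  ... | no  _ = c j

  -- 1-freezifications: for arity n ≥ 2, x ↦ ξ(c₁,…,x,…,cₙ) (x at
  -- position k; the constant c k is ignored); a unary operation is its
  -- own 1-freezification.
  data Freez1 : Set where
    freeze : (ξ : Op) → 2 ≤ arity ξ → (k : Fin (arity ξ)) →
             (c : Fin (arity ξ) → A) → Freez1
    unary  : (ξ : Op) → arity ξ ≡ 1 → Freez1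

  ⟦_⟧₁ : Freez1 → A → A
  ⟦ freeze ξ _ k c ⟧₁ x = op ξ (plug k c x)
  ⟦ unary ξ _ ⟧₁ x = op ξ (λ _ → x)

  data Freez* : Set where
    idF : Freez*
    _∘F_ : Freez1 → Freez* → Freez*

  ⟦_⟧ : Freez* → A → A
  ⟦ idF ⟧ x = x
  ⟦ φ ∘F γ ⟧ x = ⟦ φ ⟧₁ (⟦ γ ⟧ x)

  _≼[_]_ : A → Subset A → A → Set
  x ≼[ L ] y = ∀ γ → L (⟦ γ ⟧ y) → L (⟦ γ ⟧ x)

  _∼[_]_ : A → Subset A → A → Set
  x ∼[ L ] y = ∀ γ → (L (⟦ γ ⟧ y) → L (⟦ γ ⟧ x)) × (L (⟦ γ ⟧ x) → L (⟦ γ ⟧ y))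

  Xset : A → Subset A → Set
  Xset a L = Σ Freez* λ γ → (⟦ γ ⟧ ⁻¹[ L ]) a

  Yset : A → Subset A → Set
  Yset a L = Σ Freez* λ γ → ¬ (⟦ γ ⟧ ⁻¹[ L ]) a

  Compatible : (A → A → Set) → Set
  Compatible R = ∀ ξ (xs ys : Fin (arity ξ) → A) →
    (∀ j → R (xs j) (ys j)) → R (op ξ xs) (op ξ ys)

  Recognizable : Subset A → Set₁
  Recognizable L = Σ (A → A → Set) λ R →
    IsEquivalence R × Compatible R
    -- finitely many classes: finitely many representatives
    × (Σ (List A) λ reps → ∀ x → Any (R x) reps)
    -- L is a union of classes
    × (∀ x y → R x y → L x → L y)

  -- The generated families.  Each is closed under equality of subsets
  -- (constructor `ext`), as families of sets are.

  data Latt∅A (L : Subset A) : Subset A → Set₁ where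
    base  : Latt∅A L L
    empty : Latt∅A L ∅
    full  : Latt∅A L Full
    union : ∀ {X Y} → Latt∅A L X → Latt∅A L Y → Latt∅A L (X ∪ Y)
    inter : ∀ {X Y} → Latt∅A L X → Latt∅A L Y → Latt∅A L (X ∩ Y)
    pre   : ∀ {X} (γ : Freez*) → Latt∅A L X → Latt∅A L (⟦ γ ⟧ ⁻¹[ X ])
    ext   : ∀ {X Y} → X ≐ Y → Latt∅A L X → Latt∅A L Y

  data Bool∅A (L : Subset A) : Subset A → Set₁ where
    base  : Bool∅A L L
    empty : Bool∅A L ∅
    full  : Bool∅A L Full
    union : ∀ {X Y} → Bool∅A L X → Bool∅A L Y → Bool∅A L (X ∪ Y)
    inter : ∀ {X Y} → Bool∅A L X → Bool∅A L Y → Bool∅A L (X ∩ Y)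
    compl : ∀ {X} → Bool∅A L X → Bool∅A L (∁ X)
    pre   : ∀ {X} (γ : Freez*) → Bool∅A L X → Bool∅A L (⟦ γ ⟧ ⁻¹[ X ])
    ext   : ∀ {X Y} → X ≐ Y → Bool∅A L X → Bool∅A L Y

  data Latt∞ (L : Subset A) : Subset A → Set₁ where
    base  : Latt∞ L L
    unions : (I : Set) (F : I → Subset A) → (∀ i → Latt∞ L (F i)) →
             Latt∞ L (⋃ I F)
    inters : (I : Set) (F : I → Subset A) → (∀ i → Latt∞ L (F i)) →
             Latt∞ L (⋂ I F)
    pre   : ∀ {X} (γ : Freez*) → Latt∞ L X → Latt∞ L (⟦ γ ⟧ ⁻¹[ X ])
    ext   : ∀ {X Y} → X ≐ Y → Latt∞ L X → Latt∞ L Y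

  data Bool∞ (L : Subset A) : Subset A → Set₁ where
    base  : Bool∞ L L
    unions : (I : Set) (F : I → Subset A) → (∀ i → Bool∞ L (F i)) →
             Bool∞ L (⋃ I F)
    inters : (I : Set) (F : I → Subset A) → (∀ i → Bool∞ L (F i)) →
             Bool∞ L (⋂ I F)
    compl : ∀ {X} → Bool∞ L X → Bool∞ L (∁ X)
    pre   : ∀ {X} (γ : Freez*) → Bool∞ L X → Bool∞ L (⟦ γ ⟧ ⁻¹[ X ])
    ext   : ∀ {X Y} → X ≐ Y → Bool∞ L X → Bool∞ L Y

  PreservesSim : (A → A) → Subset A → Set
  PreservesSim f L = ∀ x y → x ∼[ L ] y → f x ∼[ L ] f y

  PreservesPre : (A → A) → Subset A → Set
  PreservesPre f L = ∀ x y → x ≼[ L ] y → f x ≼[ L ] f y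

{-# OPTIONS --safe #-}
module Submission where

-- Members of Bool∞(L) are unions of ∼_L-classes and members of Latt∞(L) are
-- ≼_L-down-closed, since these properties survive unions, intersections,
-- complements (for ∼_L) and preimages under freezifications; for f preserving
-- ∼_L (resp. ≼_L) the set f⁻¹(L) is of the same kind, and a class (down-set)
-- is cut out by the tests γ⁻¹(L).  If L is recognizable its congruence refines
-- ∼_L, so finitely many representatives cover A up to ∼_L.  The down-set of a
-- is then the intersection of one separating preimage γ⁻¹(L) per representative
-- not below a, a ∼_L-class is such a down-set intersected with the analogous
-- set for the complement of L, and every set of the ∞-family is the finite
-- union of the classes (down-sets) of the representatives it contains.  That
-- set is determined by a sublist of the representatives, whence finiteness.

open import Defs
open import Level using (0ℓ)
open import Data.Product using (Σ; _×_; _,_; proj₁; proj₂)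
open import Data.Sum using (inj₁; inj₂)
open import Data.Empty using (⊥; ⊥-elim)
open import Data.Unit using (tt)
open import Data.Bool using (Bool; true; false; if_then_else_)
open import Data.Fin using (Fin; _≟_)
open import Data.List using (List; []; _∷_; map; _++_; filter)
open import Data.List.Relation.Unary.Any as Any using (Any; here; toSum; fromSum)
open import Data.List.Relation.Unary.All as All using (All; []; _∷_)
open import Data.List.Membership.Propositional using (_∈_; find; lose)
open import Data.List.Membership.Propositional.Properties
  using (∈-map⁺; ∈-++⁺ˡ; ∈-++⁺ʳ; ∈-filter⁺; ∈-filter⁻)
open import Relation.Nullary using (¬_; Dec; yes; no; does)
open import Relation.Unary using (Decidable)
open import Relation.Binary.PropositionalEquality using (_≡_; refl; cong; subst; sym)
open import Relation.Binary.Structures using (IsEquivalence)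
open import Axiom.ExcludedMiddle using (ExcludedMiddle)
open import Axiom.DoubleNegationElimination using (em⇒dne)

module _ {A : Set} where

  ≐-sym : {X Y : Subset A} → X ≐ Y → Y ≐ X
  ≐-sym X≐Y x = proj₂ (X≐Y x) , proj₁ (X≐Y x)

  ≐-trans : {X Y Z : Subset A} → X ≐ Y → Y ≐ Z → X ≐ Z
  ≐-trans X≐Y Y≐Z x =
    (λ Xx → proj₁ (Y≐Z x) (proj₁ (X≐Y x) Xx)) , (λ Zx → proj₂ (X≐Y x) (proj₂ (Y≐Z x) Zx))

  ⋃-cong : {I : Set} {F G : I → Subset A} → (∀ i → F i ≐ G i) → ⋃ I F ≐ ⋃ I G
  ⋃-cong F≐G x =
    (λ (i , Fix) → i , proj₁ (F≐G i x) Fix) , (λ (i , Gix) → i , proj₂ (F≐G i x) Gix)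

  DownClosed : (A → A → Set) → Subset A → Set
  DownClosed Q X = ∀ {x y} → Q x y → X y → X x

  DownSet : (A → A → Set) → List A → Subset A
  DownSet Q S x = Any (Q x) S

  Covers : (A → A → Set) → List A → Set
  Covers Q reps = ∀ x → Any (λ s → Q x s × Q s x) reps

  Covers-mono : {Q Q′ : A → A → Set} {reps : List A} →
                (∀ {x y} → Q x y → Q′ x y) → Covers Q reps → Covers Q′ reps
  Covers-mono Q⇒Q′ cover x = Any.map (λ (x≤s , s≤x) → Q⇒Q′ x≤s , Q⇒Q′ s≤x) (cover x)

  downClosed≐⋃principal : {Q : A → A → Set} {X : Subset A} → (∀ {x} → Q x x) →
                          DownClosed Q X → X ≐ ⋃ (Σ A X) (λ p x → Q x (proj₁ p))
  downClosed≐⋃principal Q-refl X↓ x =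
    (λ Xx → (x , Xx) , Q-refl) , (λ ((a , Xa) , x≤a) → X↓ x≤a Xa)

  sublists : List A → List (List A)
  sublists []       = [] ∷ []
  sublists (x ∷ xs) = map (x ∷_) (sublists xs) ++ sublists xs

  filter∈sublists : {P : Subset A} (P? : Decidable P) (xs : List A) →
                    filter P? xs ∈ sublists xs
  filter∈sublists P? [] = here refl
  filter∈sublists P? (x ∷ xs) with does (P? x)
  ... | true  = ∈-++⁺ˡ (∈-map⁺ (x ∷_) (filter∈sublists P? xs))
  ... | false = ∈-++⁺ʳ (map (x ∷_) (sublists xs)) (filter∈sublists P? xs)

  record IsSetLattice (𝓕 : Subset A → Set₁) : Set₁ where
    field
      ≐-closed : ∀ {X Y} → X ≐ Y → 𝓕 X → 𝓕 Y
      ∅∈       : 𝓕 ∅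
      Full∈    : 𝓕 Full
      ∪-closed : ∀ {X Y} → 𝓕 X → 𝓕 Y → 𝓕 (X ∪ Y)
      ∩-closed : ∀ {X Y} → 𝓕 X → 𝓕 Y → 𝓕 (X ∩ Y)

    DownSet∈ : {Q : A → A → Set} → (∀ s → 𝓕 (λ x → Q x s)) → ∀ S → 𝓕 (DownSet Q S)
    DownSet∈ principal∈ []      = ≐-closed (λ _ → (λ ()) , (λ ())) ∅∈
    DownSet∈ principal∈ (s ∷ S) =
      ≐-closed (λ _ → fromSum , toSum) (∪-closed (principal∈ s) (DownSet∈ principal∈ S))

    All∈ : {F : A → Subset A} → (∀ s → 𝓕 (F s)) → ∀ S → 𝓕 (λ x → All (λ s → F s x) S)
    All∈ F∈ []      = ≐-closed (λ _ → (λ _ → []) , (λ _ → tt)) Full∈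
    All∈ F∈ (s ∷ S) =
      ≐-closed (λ _ → (λ (p , ps) → p ∷ ps) , (λ { (p ∷ ps) → p , ps }))
               (∩-closed (F∈ s) (All∈ F∈ S))

  isSetLattice-fromComplete :
    {𝓕 : Subset A → Set₁} →
    (∀ {X Y} → X ≐ Y → 𝓕 X → 𝓕 Y) →
    (∀ I F → (∀ i → 𝓕 (F i)) → 𝓕 (⋃ I F)) →
    (∀ I F → (∀ i → 𝓕 (F i)) → 𝓕 (⋂ I F)) →
    IsSetLattice 𝓕
  isSetLattice-fromComplete {𝓕} ≐-closed ⋃-closed ⋂-closed = record
    { ≐-closed = ≐-closed
    ; ∅∈       = ≐-closed (λ _ → (λ ()) , (λ ())) (⋃-closed ⊥ (λ ()) (λ ()))
    ; Full∈    = ≐-closed (λ _ → (λ _ → tt) , (λ _ ())) (⋂-closed ⊥ (λ ()) (λ ()))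
    ; ∪-closed = λ X∈ Y∈ → ≐-closed (λ _ → ⋃Bool⇒∪ , ∪⇒⋃Bool) (⋃-closed Bool _ (choose X∈ Y∈))
    ; ∩-closed = λ X∈ Y∈ → ≐-closed (λ _ → ⋂Bool⇒∩ , ∩⇒⋂Bool) (⋂-closed Bool _ (choose X∈ Y∈))
    }
    where
    choose : ∀ {X Y} → 𝓕 X → 𝓕 Y → ∀ b → 𝓕 (if b then X else Y)
    choose X∈ Y∈ true  = X∈
    choose X∈ Y∈ false = Y∈

    ⋃Bool⇒∪ : ∀ {X Y x} → Σ Bool (λ b → (if b then X else Y) x) → (X ∪ Y) x
    ⋃Bool⇒∪ (true  , Xx) = inj₁ Xx
    ⋃Bool⇒∪ (false , Yx) = inj₂ Yx

    ∪⇒⋃Bool : ∀ {X Y x} → (X ∪ Y) x → Σ Bool (λ b → (if b then X else Y) x)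
    ∪⇒⋃Bool (inj₁ Xx) = true  , Xx
    ∪⇒⋃Bool (inj₂ Yx) = false , Yx

    ⋂Bool⇒∩ : ∀ {X Y x} → (∀ b → (if b then X else Y) x) → (X ∩ Y) x
    ⋂Bool⇒∩ XYx = XYx true , XYx false

    ∩⇒⋂Bool : ∀ {X Y x} → (X ∩ Y) x → ∀ b → (if b then X else Y) x
    ∩⇒⋂Bool (Xx , Yx) true  = Xx
    ∩⇒⋂Bool (Xx , Yx) false = Yx

  module _ {Q : A → A → Set} {reps : List A} (cover : Covers Q reps) where

    downClosed≐DownSet : {X : Subset A} → DownClosed Q X → (X? : Decidable X) →
                         X ≐ DownSet Q (filter X? reps)
    downClosed≐DownSet X↓ X? x =
      (λ Xx → let s , s∈reps , x≤s , s≤x = find (cover x)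
              in  lose (∈-filter⁺ X? s∈reps (X↓ s≤x Xx)) x≤s) ,
      (λ x∈↓S → let s , s∈S , x≤s = find x∈↓S
                in  X↓ x≤s (proj₂ (∈-filter⁻ X? {xs = reps} s∈S)))

    downClosed∈ : {𝓕 : Subset A → Set₁} → IsSetLattice 𝓕 → (∀ s → 𝓕 (λ x → Q x s)) →
                  {X : Subset A} → DownClosed Q X → Decidable X → 𝓕 X
    downClosed∈ 𝓕-lattice principal∈ X↓ X? =
      ≐-closed (≐-sym (downClosed≐DownSet X↓ X?)) (DownSet∈ principal∈ (filter X? reps))
      where open IsSetLattice 𝓕-lattice

    downClosed-finite : {𝓕 : Subset A → Set₁} →
                        (∀ {X} → 𝓕 X → DownClosed Q X) → (∀ {X} → 𝓕 X → Decidable X) →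
                        FiniteFamily 𝓕
    downClosed-finite ↓-closed dec = map (DownSet Q) (sublists reps) , λ X X∈ →
      lose (∈-map⁺ (DownSet Q) (filter∈sublists (dec X∈) reps))
           (downClosed≐DownSet (↓-closed X∈) (dec X∈))

module Syntactic (𝒜 : Algebra) where
  open Algebra 𝒜 renaming (Carrier to A)

  ⟪_⟫ : Freez* 𝒜 → A → A
  ⟪_⟫ = ⟦_⟧ 𝒜

  infix 4 _≼⟨_⟩_ _∼⟨_⟩_

  _≼⟨_⟩_ : A → Subset A → A → Set
  x ≼⟨ M ⟩ y = _≼[_]_ 𝒜 x M y

  _∼⟨_⟩_ : A → Subset A → A → Set
  x ∼⟨ M ⟩ y = _∼[_]_ 𝒜 x M y

  infixr 9 _∘*_

  _∘*_ : Freez* 𝒜 → Freez* 𝒜 → Freez* 𝒜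
  idF      ∘* δ = δ
  (φ ∘F γ) ∘* δ = φ ∘F (γ ∘* δ)

  ⟪∘*⟫ : ∀ γ δ x → ⟪ γ ∘* δ ⟫ x ≡ ⟪ γ ⟫ (⟪ δ ⟫ x)
  ⟪∘*⟫ idF      δ x = refl
  ⟪∘*⟫ (φ ∘F γ) δ x = cong (⟦_⟧₁ 𝒜 φ) (⟪∘*⟫ γ δ x)

  module _ {M : Subset A} where

    ≼-refl : ∀ {x} → x ≼⟨ M ⟩ x
    ≼-refl γ Mγx = Mγx

    ≼-trans : ∀ {x y z} → x ≼⟨ M ⟩ y → y ≼⟨ M ⟩ z → x ≼⟨ M ⟩ z
    ≼-trans x≼y y≼z γ Mγz = x≼y γ (y≼z γ Mγz)

    ∼-refl : ∀ {x} → x ∼⟨ M ⟩ x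
    ∼-refl γ = (λ Mγx → Mγx) , (λ Mγx → Mγx)

    ∼-sym : ∀ {x y} → x ∼⟨ M ⟩ y → y ∼⟨ M ⟩ x
    ∼-sym x∼y γ = proj₂ (x∼y γ) , proj₁ (x∼y γ)

    ∼⇒≼ : ∀ {x y} → x ∼⟨ M ⟩ y → x ≼⟨ M ⟩ y
    ∼⇒≼ x∼y γ = proj₁ (x∼y γ)

    ∼⇒≼∁ : ∀ {x y} → x ∼⟨ M ⟩ y → x ≼⟨ ∁ M ⟩ y
    ∼⇒≼∁ x∼y γ ¬Mγy Mγx = ¬Mγy (proj₂ (x∼y γ) Mγx)

    ≼-⟪⟫ : ∀ γ {x y} → x ≼⟨ M ⟩ y → ⟪ γ ⟫ x ≼⟨ M ⟩ ⟪ γ ⟫ y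
    ≼-⟪⟫ γ {x} {y} x≼y δ Mδγy =
      subst M (⟪∘*⟫ δ γ x) (x≼y (δ ∘* γ) (subst M (sym (⟪∘*⟫ δ γ y)) Mδγy))

    ∼-⟪⟫ : ∀ γ {x y} → x ∼⟨ M ⟩ y → ⟪ γ ⟫ x ∼⟨ M ⟩ ⟪ γ ⟫ y
    ∼-⟪⟫ γ x∼y δ = ≼-⟪⟫ γ (∼⇒≼ x∼y) δ , ≼-⟪⟫ γ (∼⇒≼ (∼-sym x∼y)) δ

  module _ {L : Subset A} where

    Latt∞-downClosed : ∀ {X} → Latt∞ 𝒜 L X → DownClosed (_≼⟨ L ⟩_) X
    Latt∞-downClosed base             x≼y Ly       = x≼y idF Ly
    Latt∞-downClosed (unions I F F∈)  x≼y (i , Fiy) = i , Latt∞-downClosed (F∈ i) x≼y Fiy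
    Latt∞-downClosed (inters I F F∈)  x≼y Fy i     = Latt∞-downClosed (F∈ i) x≼y (Fy i)
    Latt∞-downClosed (pre γ X∈)       x≼y          = Latt∞-downClosed X∈ (≼-⟪⟫ {L} γ x≼y)
    Latt∞-downClosed (ext X≐Y X∈) {x} {y} x≼y Yy =
      proj₁ (X≐Y x) (Latt∞-downClosed X∈ x≼y (proj₂ (X≐Y y) Yy))

    Bool∞-downClosed : ∀ {X} → Bool∞ 𝒜 L X → DownClosed (_∼⟨ L ⟩_) X
    Bool∞-downClosed base             x∼y Ly       = proj₁ (x∼y idF) Ly
    Bool∞-downClosed (unions I F F∈)  x∼y (i , Fiy) = i , Bool∞-downClosed (F∈ i) x∼y Fiy
    Bool∞-downClosed (inters I F F∈)  x∼y Fy i     = Bool∞-downClosed (F∈ i) x∼y (Fy i)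
    Bool∞-downClosed (compl X∈)       x∼y ¬Xy Xx   = ¬Xy (Bool∞-downClosed X∈ (∼-sym {L} x∼y) Xx)
    Bool∞-downClosed (pre γ X∈)       x∼y          = Bool∞-downClosed X∈ (∼-⟪⟫ {L} γ x∼y)
    Bool∞-downClosed (ext X≐Y X∈) {x} {y} x∼y Yy =
      proj₁ (X≐Y x) (Bool∞-downClosed X∈ x∼y (proj₂ (X≐Y y) Yy))

    Latt∞-isSetLattice : IsSetLattice (Latt∞ 𝒜 L)
    Latt∞-isSetLattice = isSetLattice-fromComplete ext unions inters

    Bool∞-isSetLattice : IsSetLattice (Bool∞ 𝒜 L)
    Bool∞-isSetLattice = isSetLattice-fromComplete ext unions inters

    Latt∅A-isSetLattice : IsSetLattice (Latt∅A 𝒜 L)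
    Latt∅A-isSetLattice = record
      { ≐-closed = ext ; ∅∈ = empty ; Full∈ = full ; ∪-closed = union ; ∩-closed = inter }

    Bool∅A-isSetLattice : IsSetLattice (Bool∅A 𝒜 L)
    Bool∅A-isSetLattice = record
      { ≐-closed = ext ; ∅∈ = empty ; Full∈ = full ; ∪-closed = union ; ∩-closed = inter }

    module _ {𝓕 : Subset A → Set₁} (𝓕-lattice : IsSetLattice 𝓕) (L∈ : 𝓕 L)
             (pre-closed : ∀ γ {X} → 𝓕 X → 𝓕 (⟪ γ ⟫ ⁻¹[ X ])) where
      open IsSetLattice 𝓕-lattice

      Latt∅A-least : ∀ {X} → Latt∅A 𝒜 L X → 𝓕 X
      Latt∅A-least base          = L∈
      Latt∅A-least empty         = ∅∈
      Latt∅A-least full          = Full∈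
      Latt∅A-least (union X∈ Y∈) = ∪-closed (Latt∅A-least X∈) (Latt∅A-least Y∈)
      Latt∅A-least (inter X∈ Y∈) = ∩-closed (Latt∅A-least X∈) (Latt∅A-least Y∈)
      Latt∅A-least (pre γ X∈)    = pre-closed γ (Latt∅A-least X∈)
      Latt∅A-least (ext X≐Y X∈)  = ≐-closed X≐Y (Latt∅A-least X∈)

      Bool∅A-least : (∀ {X} → 𝓕 X → 𝓕 (∁ X)) → ∀ {X} → Bool∅A 𝒜 L X → 𝓕 X
      Bool∅A-least ∁-closed base          = L∈
      Bool∅A-least ∁-closed empty         = ∅∈
      Bool∅A-least ∁-closed full          = Full∈
      Bool∅A-least ∁-closed (union X∈ Y∈) =
        ∪-closed (Bool∅A-least ∁-closed X∈) (Bool∅A-least ∁-closed Y∈)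
      Bool∅A-least ∁-closed (inter X∈ Y∈) =
        ∩-closed (Bool∅A-least ∁-closed X∈) (Bool∅A-least ∁-closed Y∈)
      Bool∅A-least ∁-closed (compl X∈)    = ∁-closed (Bool∅A-least ∁-closed X∈)
      Bool∅A-least ∁-closed (pre γ X∈)    = pre-closed γ (Bool∅A-least ∁-closed X∈)
      Bool∅A-least ∁-closed (ext X≐Y X∈)  = ≐-closed X≐Y (Bool∅A-least ∁-closed X∈)

    Latt∅A⊆Latt∞ : ∀ {X} → Latt∅A 𝒜 L X → Latt∞ 𝒜 L X
    Latt∅A⊆Latt∞ = Latt∅A-least Latt∞-isSetLattice base (λ γ → pre γ)

    Bool∅A⊆Bool∞ : ∀ {X} → Bool∅A 𝒜 L X → Bool∞ 𝒜 L X
    Bool∅A⊆Bool∞ = Bool∅A-least Bool∞-isSetLattice base (λ γ → pre γ) compl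

  module _ {R : A → A → Set} (R-isEquivalence : IsEquivalence R)
           (R-compatible : Compatible 𝒜 R) where
    open IsEquivalence R-isEquivalence renaming (refl to R-refl; sym to R-sym)

    R-plug : ∀ {n} (k : Fin n) c {x y} → R x y → ∀ j → R (plug 𝒜 k c x j) (plug 𝒜 k c y j)
    R-plug k c x≈y j with j ≟ k
    ... | yes _ = x≈y
    ... | no  _ = R-refl

    R-⟪⟫ : ∀ γ {x y} → R x y → R (⟪ γ ⟫ x) (⟪ γ ⟫ y)
    R-⟪⟫ idF                     x≈y = x≈y
    R-⟪⟫ (freeze ξ _ k c ∘F γ) x≈y = R-compatible ξ _ _ (R-plug k c (R-⟪⟫ γ x≈y))
    R-⟪⟫ (unary ξ _ ∘F γ)      x≈y = R-compatible ξ _ _ (λ _ → R-⟪⟫ γ x≈y)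

    congruence⊆∼ : {L : Subset A} → (∀ x y → R x y → L x → L y) →
                   ∀ {x y} → R x y → x ∼⟨ L ⟩ y
    congruence⊆∼ L-saturated x≈y γ =
      L-saturated _ _ (R-sym (R-⟪⟫ γ x≈y)) , L-saturated _ _ (R-⟪⟫ γ x≈y)

  recognizable⇒covered : {L : Subset A} → Recognizable 𝒜 L → Σ (List A) (Covers (_∼⟨ L ⟩_))
  recognizable⇒covered {L} (R , R-isEquivalence , R-compatible , (reps , R-cover) , L-saturated) =
    reps , λ x → Any.map (λ x≈s → ≈⇒∼ x≈s , ≈⇒∼ (R-sym x≈s)) (R-cover x)
    where
    open IsEquivalence R-isEquivalence renaming (sym to R-sym)
    ≈⇒∼ : ∀ {x y} → R x y → x ∼⟨ L ⟩ y
    ≈⇒∼ = congruence⊆∼ R-isEquivalence R-compatible L-saturated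

  module _ {L : Subset A} (f : A → A) where

    PreservesSim⇒downClosed : PreservesSim 𝒜 f L → DownClosed (_∼⟨ L ⟩_) (f ⁻¹[ L ])
    PreservesSim⇒downClosed f-pres x∼y Lfy = proj₁ (f-pres _ _ x∼y idF) Lfy

    PreservesPre⇒downClosed : PreservesPre 𝒜 f L → DownClosed (_≼⟨ L ⟩_) (f ⁻¹[ L ])
    PreservesPre⇒downClosed f-pres x≼y Lfy = f-pres _ _ x≼y idF Lfy

  module _ {L : Subset A} where

    ≼-principal≐tests : ∀ a → (_≼⟨ L ⟩ a) ≐ ⋂ (Xset 𝒜 a L) (λ q → ⟪ proj₁ q ⟫ ⁻¹[ L ])
    ≼-principal≐tests a x = (λ x≼a (γ , Lγa) → x≼a γ Lγa) , (λ x∈tests γ Lγa → x∈tests (γ , Lγa))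

    ≼-tests∈Latt∞ : ∀ a → Latt∞ 𝒜 L (⋂ (Xset 𝒜 a L) (λ q → ⟪ proj₁ q ⟫ ⁻¹[ L ]))
    ≼-tests∈Latt∞ a = inters _ _ (λ q → pre (proj₁ q) base)

    ∼-tests∈Bool∞ : ∀ a → Bool∞ 𝒜 L (⋂ (Xset 𝒜 a L) (λ q → ⟪ proj₁ q ⟫ ⁻¹[ L ])
                                     ∩ ⋂ (Yset 𝒜 a L) (λ q → ∁ (⟪ proj₁ q ⟫ ⁻¹[ L ])))
    ∼-tests∈Bool∞ a = ∩-closed (inters _ _ (λ q → pre (proj₁ q) base))
                               (inters _ _ (λ q → compl (pre (proj₁ q) base)))
      where open IsSetLattice Bool∞-isSetLattice

  module Classical (em : ExcludedMiddle 0ℓ) where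

    dne : {P : Set} → ¬ ¬ P → P
    dne = em⇒dne em

    module _ {M : Subset A} where

      ≼×≼∁⇒∼ : ∀ {x y} → x ≼⟨ M ⟩ y → x ≼⟨ ∁ M ⟩ y → x ∼⟨ M ⟩ y
      ≼×≼∁⇒∼ x≼y x≼∁y γ = x≼y γ , λ Mγx → dne (λ ¬Mγy → x≼∁y γ ¬Mγy Mγx)

      separator : ∀ {x a} → ¬ (x ≼⟨ M ⟩ a) → Σ (Freez* 𝒜) λ γ → M (⟪ γ ⟫ a) × ¬ M (⟪ γ ⟫ x)
      separator x⋠a = dne λ ¬sep → x⋠a λ γ Mγa → dne λ ¬Mγx → ¬sep (γ , Mγa , ¬Mγx)

      module _ {𝓕 : Subset A → Set₁} (𝓕-lattice : IsSetLattice 𝓕)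
               (pre∈ : ∀ γ → 𝓕 (⟪ γ ⟫ ⁻¹[ M ]))
               {reps : List A} (cover : Covers (_≼⟨ M ⟩_) reps) (a : A) where
        open IsSetLattice 𝓕-lattice

        test : ∀ {s} → Dec (s ≼⟨ M ⟩ a) → Subset A
        test (yes _)   = Full
        test (no s⋠a) = ⟪ proj₁ (separator s⋠a) ⟫ ⁻¹[ M ]

        test∈ : ∀ {s} (s≼a? : Dec (s ≼⟨ M ⟩ a)) → 𝓕 (test s≼a?)
        test∈ (yes _)   = Full∈
        test∈ (no s⋠a) = pre∈ (proj₁ (separator s⋠a))

        ≼⇒test : ∀ {s x} (s≼a? : Dec (s ≼⟨ M ⟩ a)) → x ≼⟨ M ⟩ a → test s≼a? x
        ≼⇒test (yes _)   x≼a = tt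
        ≼⇒test (no s⋠a) x≼a = let γ , Mγa , _ = separator s⋠a in x≼a γ Mγa

        test⇒≼ : ∀ {s x} (s≼a? : Dec (s ≼⟨ M ⟩ a)) →
                 x ≼⟨ M ⟩ s → s ≼⟨ M ⟩ x → test s≼a? x → x ≼⟨ M ⟩ a
        test⇒≼ (yes s≼a) x≼s s≼x _   = ≼-trans {M} x≼s s≼a
        test⇒≼ (no s⋠a) x≼s s≼x Mγx =
          let γ , _ , ¬Mγs = separator s⋠a in ⊥-elim (¬Mγs (s≼x γ Mγx))

        ≼-principal∈ : 𝓕 (_≼⟨ M ⟩ a)
        ≼-principal∈ = ≐-closed tests≐principal (All∈ (λ s → test∈ {s} em) reps)
          where
          tests≐principal : (λ x → All (λ s → test {s} em x) reps) ≐ (_≼⟨ M ⟩ a)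
          tests≐principal x =
            (λ x∈tests →
               All.lookupWith (λ t (x≼s , s≼x) → test⇒≼ em x≼s s≼x t) x∈tests (cover x)) ,
            (λ x≼a → All.universal (λ s → ≼⇒test em x≼a) reps)

    module _ {L : Subset A} where

      ∼-principal≐tests : ∀ a → (_∼⟨ L ⟩ a) ≐ (⋂ (Xset 𝒜 a L) (λ q → ⟪ proj₁ q ⟫ ⁻¹[ L ])
                                              ∩ ⋂ (Yset 𝒜 a L) (λ q → ∁ (⟪ proj₁ q ⟫ ⁻¹[ L ])))
      ∼-principal≐tests a x =
        (λ x∼a → (λ (γ , Lγa) → proj₁ (x∼a γ) Lγa) ,
                 (λ (γ , ¬Lγa) Lγx → ¬Lγa (proj₂ (x∼a γ) Lγx))) ,
        (λ (x∈X-tests , x∈Y-tests) γ →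
           (λ Lγa → x∈X-tests (γ , Lγa)) , (λ Lγx → dne λ ¬Lγa → x∈Y-tests (γ , ¬Lγa) Lγx))

      preimage∈Bool∞ : (f : A → A) → PreservesSim 𝒜 f L → Bool∞ 𝒜 L (f ⁻¹[ L ])
      preimage∈Bool∞ f f-pres =
        ext (≐-sym (≐-trans (downClosed≐⋃principal (∼-refl {L})
                                                    (PreservesSim⇒downClosed {L} f f-pres))
                            (⋃-cong (λ p → ∼-principal≐tests (proj₁ p)))))
            (unions _ _ (λ p → ∼-tests∈Bool∞ {L} (proj₁ p)))

      preimage∈Latt∞ : (f : A → A) → PreservesPre 𝒜 f L → Latt∞ 𝒜 L (f ⁻¹[ L ])
      preimage∈Latt∞ f f-pres =
        ext (≐-sym (≐-trans (downClosed≐⋃principal (≼-refl {L})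
                                                    (PreservesPre⇒downClosed {L} f f-pres))
                            (⋃-cong (λ p → ≼-principal≐tests {L} (proj₁ p)))))
            (unions _ _ (λ p → ≼-tests∈Latt∞ {L} (proj₁ p)))

      module _ {reps : List A} (cover : Covers (_∼⟨ L ⟩_) reps) where

        ≼-principal∈Latt∅A : ∀ a → Latt∅A 𝒜 L (_≼⟨ L ⟩ a)
        ≼-principal∈Latt∅A =
          ≼-principal∈ {L} Latt∅A-isSetLattice (λ γ → pre γ base) (Covers-mono (∼⇒≼ {L}) cover)

        ∼-principal∈Bool∅A : ∀ a → Bool∅A 𝒜 L (_∼⟨ L ⟩ a)
        ∼-principal∈Bool∅A a =
          ext (λ x → (λ (x≼a , x≼∁a) → ≼×≼∁⇒∼ {L} x≼a x≼∁a) ,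
                     (λ x∼a → ∼⇒≼ {L} x∼a , ∼⇒≼∁ {L} x∼a))
              (inter (≼-principal∈ {L} Bool∅A-isSetLattice (λ γ → pre γ base)
                                   (Covers-mono (∼⇒≼ {L}) cover) a)
                     (≼-principal∈ {∁ L} Bool∅A-isSetLattice (λ γ → compl (pre γ base))
                                   (Covers-mono (∼⇒≼∁ {L}) cover) a))

      Bool∅A-recognizable : Recognizable 𝒜 L →
                            SameFamily (Bool∅A 𝒜 L) (Bool∞ 𝒜 L) × FiniteFamily (Bool∅A 𝒜 L)
      Bool∅A-recognizable L-rec =
        ( (λ _ → Bool∅A⊆Bool∞)
        , (λ _ X∈ → downClosed∈ cover Bool∅A-isSetLattice (∼-principal∈Bool∅A cover)
                                (Bool∞-downClosed X∈) (λ _ → em)) )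
        , downClosed-finite cover (λ X∈ → Bool∞-downClosed (Bool∅A⊆Bool∞ X∈)) (λ _ _ → em)
        where
        cover : Covers (_∼⟨ L ⟩_) (proj₁ (recognizable⇒covered L-rec))
        cover = proj₂ (recognizable⇒covered L-rec)

      Latt∅A-recognizable : Recognizable 𝒜 L →
                            SameFamily (Latt∅A 𝒜 L) (Latt∞ 𝒜 L) × FiniteFamily (Latt∅A 𝒜 L)
      Latt∅A-recognizable L-rec =
        ( (λ _ → Latt∅A⊆Latt∞)
        , (λ _ X∈ → downClosed∈ ≼-cover Latt∅A-isSetLattice (≼-principal∈Latt∅A cover)
                                (Latt∞-downClosed X∈) (λ _ → em)) )
        , downClosed-finite ≼-cover (λ X∈ → Latt∞-downClosed (Latt∅A⊆Latt∞ X∈)) (λ _ _ → em)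
        where
        cover : Covers (_∼⟨ L ⟩_) (proj₁ (recognizable⇒covered L-rec))
        cover = proj₂ (recognizable⇒covered L-rec)
        ≼-cover : Covers (_≼⟨ L ⟩_) (proj₁ (recognizable⇒covered L-rec))
        ≼-cover = Covers-mono (∼⇒≼ {L}) cover

lemma4p8 : ExcludedMiddle 0ℓ → (𝒜 : Algebra) →
  let A = Algebra.Carrier 𝒜 in
  (f : A → A) (L : Subset A) →
  -- (1)
  ( (PreservesSim 𝒜 f L →
       ((f ⁻¹[ L ]) ≐ ⋃ (Σ A λ a → (f ⁻¹[ L ]) a)
                        (λ p → λ x → _∼[_]_ 𝒜 x L (Σ.proj₁ p)))
     × (⋃ (Σ A λ a → (f ⁻¹[ L ]) a) (λ p → λ x → _∼[_]_ 𝒜 x L (Σ.proj₁ p))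
         ≐ ⋃ (Σ A λ a → (f ⁻¹[ L ]) a)
             (λ p → ⋂ (Xset 𝒜 (Σ.proj₁ p) L) (λ q → ⟦_⟧ 𝒜 (Σ.proj₁ q) ⁻¹[ L ])
                  ∩ ⋂ (Yset 𝒜 (Σ.proj₁ p) L) (λ q → ∁ (⟦_⟧ 𝒜 (Σ.proj₁ q) ⁻¹[ L ]))))
     × Bool∞ 𝒜 L (f ⁻¹[ L ]))
  × (Recognizable 𝒜 L →
       SameFamily (Bool∅A 𝒜 L) (Bool∞ 𝒜 L) × FiniteFamily (Bool∅A 𝒜 L)) )
  ×
  -- (2)
  ( (PreservesPre 𝒜 f L →
       ((f ⁻¹[ L ]) ≐ ⋃ (Σ A λ a → (f ⁻¹[ L ]) a)
                        (λ p → λ x → _≼[_]_ 𝒜 x L (Σ.proj₁ p)))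
     × (⋃ (Σ A λ a → (f ⁻¹[ L ]) a) (λ p → λ x → _≼[_]_ 𝒜 x L (Σ.proj₁ p))
         ≐ ⋃ (Σ A λ a → (f ⁻¹[ L ]) a)
             (λ p → ⋂ (Xset 𝒜 (Σ.proj₁ p) L) (λ q → ⟦_⟧ 𝒜 (Σ.proj₁ q) ⁻¹[ L ])))
     × Latt∞ 𝒜 L (f ⁻¹[ L ]))
  × (Recognizable 𝒜 L →
       SameFamily (Latt∅A 𝒜 L) (Latt∞ 𝒜 L) × FiniteFamily (Latt∅A 𝒜 L)) )
lemma4p8 em 𝒜 f L =
  ( (λ f-pres → downClosed≐⋃principal (∼-refl {L}) (PreservesSim⇒downClosed {L} f f-pres)
              , ⋃-cong (λ p → ∼-principal≐tests {L} (proj₁ p))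
              , preimage∈Bool∞ f f-pres)
  , Bool∅A-recognizable )
  , ( (λ f-pres → downClosed≐⋃principal (≼-refl {L}) (PreservesPre⇒downClosed {L} f f-pres)
                , ⋃-cong (λ p → ≼-principal≐tests {L} (proj₁ p))
                , preimage∈Latt∞ f f-pres)
    , Latt∅A-recognizable )
  where
  open Syntactic 𝒜
  open Classical em
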